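{- Let $m\ge 1$. For every integer $n\ge 0$, $$\sum_{k=0}^{n}(-1)^{n-k}\binom{n-k}{k}_m=\chi_{m+1}(n).$$
   Context: Let $p_m(t)=1+t+\cdots+t^m$. For integers $N,k\ge 0$, $\binom{N}{k}_m$ is the coefficient of $t^k$ in $p_m(t)^N$. For $j\ge 0$ and $r\ge 0$, $\chi_r(j)$ is the coefficient of $t^j$ in $1/p_r(t)$; explicitly $\chi_r(j)=1$ if $j\equiv 0\pmod{r+1}$, $-1$ if $j\equiv1\pmod{r+1}$, and $0$ otherwise. -}

module Defs where

open import Data.Nat using (ℕ; zero; suc; _+_; _*_; _∸_)
open import Data.Nat.DivMod using (_%_)
open import Data.Integer as ℤ using (ℤ; +_; -_)
open import Data.List using (List; []; _∷_; replicate; sum; map; upTo)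

-- Polynomials with ℕ coefficients as coefficient lists (constant term first).
Poly : Set
Poly = List ℕ

_⊕_ : Poly → Poly → Poly
[] ⊕ q = q
(a ∷ p) ⊕ [] = a ∷ p
(a ∷ p) ⊕ (b ∷ q) = (a + b) ∷ (p ⊕ q)

scale : ℕ → Poly → Poly
scale c = map (c *_)

_⊗_ : Poly → Poly → Poly
[] ⊗ q = []
(a ∷ p) ⊗ q = scale a q ⊕ (0 ∷ (p ⊗ q))

_⊗^_ : Poly → ℕ → Poly
p ⊗^ zero = 1 ∷ []
p ⊗^ suc n = p ⊗ (p ⊗^ n)

coeff : Poly → ℕ → ℕ
coeff [] k = 0
coeff (a ∷ p) zero = a
coeff (a ∷ p) (suc k) = coeff p k

pm : ℕ → Poly
pm m = replicate (suc m) 1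

binomM : ℕ → ℕ → ℕ → ℕ
binomM m N k = coeff (pm m ⊗^ N) k

-- χ_r(j) = [t^j] 1/p_r(t): 1 if j ≡ 0, -1 if j ≡ 1 (mod r+1), 0 otherwise
χ : ℕ → ℕ → ℤ
χ r j with j % suc r
... | zero = + 1
... | suc zero = - (+ 1)
... | suc (suc _) = + 0

sgn : ℕ → ℤ
sgn zero = + 1
sgn (suc e) = - sgn e

lhsSum : ℕ → ℕ → ℤ
lhsSum m n = Data.List.foldr ℤ._+_ (+ 0)
  (map (λ k → sgn (n ∸ k) ℤ.* (+ binomM m (n ∸ k) k)) (upTo (suc n)))

{-# OPTIONS --safe #-}
module Submission where

open import Defs
open import Data.Nat using (ℕ; zero; suc; _+_; _∸_; _*_; _≥_; _≤_; _<_; z≤n; s≤s)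
open import Data.Nat.Properties
open import Data.Nat.DivMod using (_%_; _/_; m%n<n; m≡m%n+[m/n]*n)
open import Data.Integer as ℤ using (ℤ; +_; -_)
import Data.Integer.Properties as ℤₚ
open import Data.Integer.Tactic.RingSolver using (solve-∀)
open import Data.List using ([]; _∷_; replicate; map; foldr; applyUpTo)
open import Function using (_∘_; id)
open import Relation.Binary.PropositionalEquality
  using (_≡_; refl; sym; trans; cong; cong₂; module ≡-Reasoning)
open ≡-Reasoning

-- Since p_{m+1}(t) = 1 + t·p_m(t), the power series 1/p_{m+1}(t) is the alternating
-- geometric series Σ_N (-1)^N t^N p_m(t)^N, whose coefficient of t^n is exactly the
-- left-hand side (the term N = n - k contributes (-1)^(n-k) binom(n-k, k)_m).
-- On the other hand, the coefficients a(n) of 1/p_{m+1}(t) obey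
-- a(n+1) = -(a(n) + a(n-1) + ⋯ + a(n-m)), which gives the initial values 1, -1, 0, …, 0
-- and, by subtracting consecutive instances, the period m + 2.

window : ℕ → (ℕ → ℤ) → ℕ → ℤ
window zero    g n       = + 0
window (suc L) g zero    = g 0
window (suc L) g (suc n) = g (suc n) ℤ.+ window L g n

window-cong : ∀ L {f g} n → (∀ i → i ≤ n → f i ≡ g i) → window L f n ≡ window L g n
window-cong zero    n       f≗g = refl
window-cong (suc L) zero    f≗g = f≗g 0 z≤n
window-cong (suc L) (suc n) f≗g =
  cong₂ ℤ._+_ (f≗g (suc n) ≤-refl) (window-cong L n (λ i i≤n → f≗g i (m≤n⇒m≤1+n i≤n)))

window-vanishes : ∀ L {g} n → (∀ i → i ≤ n → g i ≡ + 0) → window L g n ≡ + 0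
window-vanishes zero    n       g≗0 = refl
window-vanishes (suc L) zero    g≗0 = g≗0 0 z≤n
window-vanishes (suc L) (suc n) g≗0 =
  cong₂ ℤ._+_ (g≗0 (suc n) ≤-refl) (window-vanishes L n (λ i i≤n → g≗0 i (m≤n⇒m≤1+n i≤n)))

window-+ : ∀ L f g n → window L (λ i → f i ℤ.+ g i) n ≡ window L f n ℤ.+ window L g n
window-+ zero    f g n       = refl
window-+ (suc L) f g zero    = refl
window-+ (suc L) f g (suc n) = begin
  (f (suc n) ℤ.+ g (suc n)) ℤ.+ window L (λ i → f i ℤ.+ g i) n
    ≡⟨ cong (ℤ._+_ (f (suc n) ℤ.+ g (suc n))) (window-+ L f g n) ⟩
  (f (suc n) ℤ.+ g (suc n)) ℤ.+ (window L f n ℤ.+ window L g n)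
    ≡⟨ interchange (f (suc n)) (g (suc n)) (window L f n) (window L g n) ⟩
  (f (suc n) ℤ.+ window L f n) ℤ.+ (g (suc n) ℤ.+ window L g n) ∎
  where
  interchange : ∀ a b c d → (a ℤ.+ b) ℤ.+ (c ℤ.+ d) ≡ (a ℤ.+ c) ℤ.+ (b ℤ.+ d)
  interchange = solve-∀

window-*ˡ : ∀ L s f n → window L (λ i → s ℤ.* f i) n ≡ s ℤ.* window L f n
window-*ˡ zero    s f n       = sym (ℤₚ.*-zeroʳ s)
window-*ˡ (suc L) s f zero    = refl
window-*ˡ (suc L) s f (suc n) = begin
  s ℤ.* f (suc n) ℤ.+ window L (λ i → s ℤ.* f i) n
    ≡⟨ cong (ℤ._+_ (s ℤ.* f (suc n))) (window-*ˡ L s f n) ⟩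
  s ℤ.* f (suc n) ℤ.+ s ℤ.* window L f n
    ≡⟨ ℤₚ.*-distribˡ-+ s (f (suc n)) (window L f n) ⟨
  s ℤ.* (f (suc n) ℤ.+ window L f n) ∎

window-shift : ∀ L M g k → (∀ i → i < M → g i ≡ + 0) →
               window L g (M + k) ≡ window L (λ i → g (M + i)) k
window-shift zero    M       g k       g<M≗0 = refl
window-shift (suc L) zero    g zero    g<M≗0 = refl
window-shift (suc L) (suc M) g zero    g<M≗0 = begin
  window (suc L) g (suc M + 0)
    ≡⟨ cong (window (suc L) g ∘ suc) (+-identityʳ M) ⟩
  g (suc M) ℤ.+ window L g M
    ≡⟨ cong (ℤ._+_ (g (suc M))) (window-vanishes L M (λ i i≤M → g<M≗0 i (s≤s i≤M))) ⟩
  g (suc M) ℤ.+ + 0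
    ≡⟨ ℤₚ.+-identityʳ (g (suc M)) ⟩
  g (suc M) ≡⟨ cong (g ∘ suc) (+-identityʳ M) ⟨
  g (suc M + 0) ∎
window-shift (suc L) M       g (suc k) g<M≗0 = begin
  window (suc L) g (M + suc k)
    ≡⟨ cong (window (suc L) g) (+-suc M k) ⟩
  g (suc (M + k)) ℤ.+ window L g (M + k)
    ≡⟨ cong (ℤ._+_ (g (suc (M + k)))) (window-shift L M g k g<M≗0) ⟩
  g (suc (M + k)) ℤ.+ window L (λ i → g (M + i)) k
    ≡⟨ cong (λ i → g i ℤ.+ window L (λ i → g (M + i)) k) (+-suc M k) ⟨
  g (M + suc k) ℤ.+ window L (λ i → g (M + i)) k ∎

window-last : ∀ L g k → window (suc L) g (L + k) ≡ window L g (L + k) ℤ.+ g k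
window-last zero    g zero    = sym (ℤₚ.+-identityˡ (g 0))
window-last zero    g (suc k) = trans (ℤₚ.+-identityʳ (g (suc k))) (sym (ℤₚ.+-identityˡ (g (suc k))))
window-last (suc L) g k       = begin
  g (suc (L + k)) ℤ.+ window (suc L) g (L + k)
    ≡⟨ cong (ℤ._+_ (g (suc (L + k)))) (window-last L g k) ⟩
  g (suc (L + k)) ℤ.+ (window L g (L + k) ℤ.+ g k)
    ≡⟨ ℤₚ.+-assoc (g (suc (L + k))) (window L g (L + k)) (g k) ⟨
  g (suc (L + k)) ℤ.+ window L g (L + k) ℤ.+ g k ∎

window-saturated : ∀ L g n → n < L → window L g n ≡ window (suc n) g n
window-saturated (suc L) g zero    n<L       = refl
window-saturated (suc L) g (suc n) (s≤s n<L) = cong (ℤ._+_ (g (suc n))) (window-saturated L g n n<L)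

coeff-⊕ : ∀ p q k → coeff (p ⊕ q) k ≡ coeff p k + coeff q k
coeff-⊕ []      q       k       = refl
coeff-⊕ (a ∷ p) []      k       = sym (+-identityʳ _)
coeff-⊕ (a ∷ p) (b ∷ q) zero    = refl
coeff-⊕ (a ∷ p) (b ∷ q) (suc k) = coeff-⊕ p q k

coeff-scale : ∀ c q k → coeff (scale c q) k ≡ c * coeff q k
coeff-scale c []      k       = sym (*-zeroʳ c)
coeff-scale c (a ∷ q) zero    = refl
coeff-scale c (a ∷ q) (suc k) = coeff-scale c q k

coeff-ones-⊗ : ∀ L q n → + coeff (replicate L 1 ⊗ q) n ≡ window L (+_ ∘ coeff q) n
coeff-ones-⊗ zero    q n       = refl
coeff-ones-⊗ (suc L) q zero    = cong +_ (begin
  coeff (scale 1 q ⊕ (0 ∷ (replicate L 1 ⊗ q))) 0 ≡⟨ coeff-⊕ (scale 1 q) _ 0 ⟩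
  coeff (scale 1 q) 0 + 0 ≡⟨ +-identityʳ _ ⟩
  coeff (scale 1 q) 0     ≡⟨ coeff-scale 1 q 0 ⟩
  1 * coeff q 0           ≡⟨ *-identityˡ _ ⟩
  coeff q 0               ∎)
coeff-ones-⊗ (suc L) q (suc n) = begin
  + coeff (scale 1 q ⊕ (0 ∷ (replicate L 1 ⊗ q))) (suc n)
    ≡⟨ cong +_ (coeff-⊕ (scale 1 q) _ (suc n)) ⟩
  + coeff (scale 1 q) (suc n) ℤ.+ + coeff (replicate L 1 ⊗ q) n
    ≡⟨ cong₂ ℤ._+_ (cong +_ (trans (coeff-scale 1 q (suc n)) (*-identityˡ _))) (coeff-ones-⊗ L q n) ⟩
  + coeff q (suc n) ℤ.+ window L (+_ ∘ coeff q) n ∎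

binomM-suc : ∀ m N k → + binomM m (suc N) k ≡ window (suc m) (+_ ∘ binomM m N) k
binomM-suc m N = coeff-ones-⊗ (suc m) (pm m ⊗^ N)

∑ : ℕ → (ℕ → ℤ) → ℤ
∑ zero    f = + 0
∑ (suc B) f = f 0 ℤ.+ ∑ B (f ∘ suc)

∑-cong : ∀ B {f g} → (∀ i → i < B → f i ≡ g i) → ∑ B f ≡ ∑ B g
∑-cong zero    f≗g = refl
∑-cong (suc B) f≗g = cong₂ ℤ._+_ (f≗g 0 (s≤s z≤n)) (∑-cong B (λ i i<B → f≗g (suc i) (s≤s i<B)))

∑-vanishes : ∀ B {f} → (∀ i → f i ≡ + 0) → ∑ B f ≡ + 0
∑-vanishes zero    f≗0 = refl
∑-vanishes (suc B) f≗0 = cong₂ ℤ._+_ (f≗0 0) (∑-vanishes B (f≗0 ∘ suc))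

∑-neg : ∀ B f → ∑ B (λ i → - f i) ≡ - ∑ B f
∑-neg zero    f = refl
∑-neg (suc B) f = trans (cong (ℤ._+_ (- f 0)) (∑-neg B (f ∘ suc))) (sym (ℤₚ.neg-distrib-+ (f 0) (∑ B (f ∘ suc))))

∑-suc-last : ∀ B f → ∑ (suc B) f ≡ ∑ B f ℤ.+ f B
∑-suc-last zero    f = trans (ℤₚ.+-identityʳ (f 0)) (sym (ℤₚ.+-identityˡ (f 0)))
∑-suc-last (suc B) f = begin
  f 0 ℤ.+ ∑ (suc B) (f ∘ suc)          ≡⟨ cong (ℤ._+_ (f 0)) (∑-suc-last B (f ∘ suc)) ⟩
  f 0 ℤ.+ (∑ B (f ∘ suc) ℤ.+ f (suc B)) ≡⟨ ℤₚ.+-assoc (f 0) (∑ B (f ∘ suc)) (f (suc B)) ⟨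
  f 0 ℤ.+ ∑ B (f ∘ suc) ℤ.+ f (suc B)   ∎

∑-reverse : ∀ n f → ∑ (suc n) f ≡ ∑ (suc n) (λ k → f (n ∸ k))
∑-reverse zero    f = refl
∑-reverse (suc n) f = begin
  f 0 ℤ.+ ∑ (suc n) (f ∘ suc)
    ≡⟨ cong (ℤ._+_ (f 0)) (∑-reverse n (f ∘ suc)) ⟩
  f 0 ℤ.+ ∑ (suc n) (λ k → f (suc (n ∸ k)))
    ≡⟨ cong (ℤ._+_ (f 0)) (∑-cong (suc n) (λ k k≤n → cong f (sym (+-∸-assoc 1 (≤-pred k≤n))))) ⟩
  f 0 ℤ.+ ∑ (suc n) (λ k → f (suc n ∸ k))
    ≡⟨ ℤₚ.+-comm (f 0) _ ⟩
  ∑ (suc n) (λ k → f (suc n ∸ k)) ℤ.+ f 0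
    ≡⟨ cong (λ i → ∑ (suc n) (λ k → f (suc n ∸ k)) ℤ.+ f i) (n∸n≡0 n) ⟨
  ∑ (suc n) (λ k → f (suc n ∸ k)) ℤ.+ f (n ∸ n)
    ≡⟨ ∑-suc-last (suc n) (λ k → f (suc n ∸ k)) ⟨
  ∑ (suc (suc n)) (λ k → f (suc n ∸ k)) ∎

∑-split : ∀ a b f → ∑ (a + b) f ≡ ∑ a f ℤ.+ ∑ b (λ i → f (a + i))
∑-split zero    b f = sym (ℤₚ.+-identityˡ _)
∑-split (suc a) b f = trans (cong (ℤ._+_ (f 0)) (∑-split a b (f ∘ suc)))
  (sym (ℤₚ.+-assoc (f 0) (∑ a (f ∘ suc)) (∑ b (λ i → f (suc (a + i))))))

∑-truncate : ∀ {b B} f → b ≤ B → (∀ i → f (b + i) ≡ + 0) → ∑ B f ≡ ∑ b f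
∑-truncate {b} {B} f b≤B tail≗0 = begin
  ∑ B f                                      ≡⟨ cong (λ B → ∑ B f) (m+[n∸m]≡n b≤B) ⟨
  ∑ (b + (B ∸ b)) f                          ≡⟨ ∑-split b (B ∸ b) f ⟩
  ∑ b f ℤ.+ ∑ (B ∸ b) (λ i → f (b + i))     ≡⟨ cong (ℤ._+_ (∑ b f)) (∑-vanishes (B ∸ b) tail≗0) ⟩
  ∑ b f ℤ.+ + 0                              ≡⟨ ℤₚ.+-identityʳ (∑ b f) ⟩
  ∑ b f                                      ∎

window-∑ : ∀ L B (F : ℕ → ℕ → ℤ) n →
           window L (λ i → ∑ B (λ N → F N i)) n ≡ ∑ B (λ N → window L (F N) n)
window-∑ L zero    F n = window-vanishes L n (λ _ _ → refl)
window-∑ L (suc B) F n = trans (window-+ L (F 0) (λ i → ∑ B (λ N → F (suc N) i)) n)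
  (cong (ℤ._+_ (window L (F 0) n)) (window-∑ L B (F ∘ suc) n))

foldr-map-applyUpTo : ∀ n (h : ℕ → ℤ) f →
                      foldr ℤ._+_ (+ 0) (map h (applyUpTo f n)) ≡ ∑ n (h ∘ f)
foldr-map-applyUpTo zero    h f = refl
foldr-map-applyUpTo (suc n) h f = cong (ℤ._+_ (h (f 0))) (foldr-map-applyUpTo n h (f ∘ suc))

χ₀ : ℕ → ℤ
χ₀ zero          = + 1
χ₀ (suc zero)    = - (+ 1)
χ₀ (suc (suc _)) = + 0

χ≡χ₀-mod : ∀ r j → χ r j ≡ χ₀ (j % suc r)
χ≡χ₀-mod r j with j % suc r
... | zero        = refl
... | suc zero    = refl
... | suc (suc _) = refl

module InverseOfP (m : ℕ) where

  -- tpCoeff N n is the coefficient of t^n in (t·p_m(t))^N.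
  tpCoeff : ℕ → ℕ → ℤ
  tpCoeff zero    zero    = + 1
  tpCoeff zero    (suc n) = + 0
  tpCoeff (suc N) zero    = + 0
  tpCoeff (suc N) (suc n) = window (suc m) (tpCoeff N) n

  tpCoeff-vanishes : ∀ {N n} → n < N → tpCoeff N n ≡ + 0
  tpCoeff-vanishes {suc N} {zero}  _         = refl
  tpCoeff-vanishes {suc N} {suc n} (s≤s n<N) =
    window-vanishes (suc m) n (λ i i≤n → tpCoeff-vanishes (<-≤-trans (s≤s i≤n) n<N))

  tpCoeff-binomM : ∀ N k → tpCoeff N (N + k) ≡ + binomM m N k
  tpCoeff-binomM zero    zero    = refl
  tpCoeff-binomM zero    (suc k) = refl
  tpCoeff-binomM (suc N) k       = begin
    window (suc m) (tpCoeff N) (N + k)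
      ≡⟨ window-shift (suc m) N (tpCoeff N) k (λ i → tpCoeff-vanishes) ⟩
    window (suc m) (λ i → tpCoeff N (N + i)) k
      ≡⟨ window-cong (suc m) k (λ i _ → tpCoeff-binomM N i) ⟩
    window (suc m) (+_ ∘ binomM m N) k
      ≡⟨ binomM-suc m N k ⟨
    + binomM m (suc N) k ∎

  partialInverse : ℕ → ℕ → ℤ
  partialInverse B n = ∑ B (λ N → sgn N ℤ.* tpCoeff N n)

  -- The coefficient of t^n in 1/p_{m+1}(t) = Σ_N (-1)^N (t·p_m(t))^N; terms N > n vanish.
  inverse : ℕ → ℤ
  inverse n = partialInverse (suc n) n

  partialInverse-stable : ∀ {B n} → n < B → partialInverse B n ≡ inverse n
  partialInverse-stable {B} {n} n<B = ∑-truncate _ n<B (λ i →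
    trans (cong (sgn (suc n + i) ℤ.*_) (tpCoeff-vanishes (s≤s (m≤m+n n i))))
          (ℤₚ.*-zeroʳ (sgn (suc n + i))))

  partialInverse-suc : ∀ B n → partialInverse (suc B) (suc n) ≡ - window (suc m) (partialInverse B) n
  partialInverse-suc B n = begin
    + 0 ℤ.+ ∑ B (λ N → - sgn N ℤ.* window (suc m) (tpCoeff N) n)
      ≡⟨ ℤₚ.+-identityˡ _ ⟩
    ∑ B (λ N → - sgn N ℤ.* window (suc m) (tpCoeff N) n)
      ≡⟨ ∑-cong B (λ N _ → ℤₚ.neg-distribˡ-* (sgn N) _) ⟨
    ∑ B (λ N → - (sgn N ℤ.* window (suc m) (tpCoeff N) n))
      ≡⟨ ∑-neg B _ ⟩
    - ∑ B (λ N → sgn N ℤ.* window (suc m) (tpCoeff N) n)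
      ≡⟨ cong -_ (∑-cong B (λ N _ → window-*ˡ (suc m) (sgn N) (tpCoeff N) n)) ⟨
    - ∑ B (λ N → window (suc m) (λ i → sgn N ℤ.* tpCoeff N i) n)
      ≡⟨ cong -_ (window-∑ (suc m) B (λ N i → sgn N ℤ.* tpCoeff N i) n) ⟨
    - window (suc m) (partialInverse B) n ∎

  inverse-suc : ∀ n → inverse (suc n) ≡ - window (suc m) inverse n
  inverse-suc n = trans (partialInverse-suc (suc n) n)
    (cong -_ (window-cong (suc m) n (λ i i≤n → partialInverse-stable (s≤s i≤n))))

  lhsSum≡inverse : ∀ n → lhsSum m n ≡ inverse n
  lhsSum≡inverse n = begin
    lhsSum m n                    ≡⟨ foldr-map-applyUpTo (suc n) term id ⟩
    ∑ (suc n) term                ≡⟨ ∑-reverse n term ⟩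
    ∑ (suc n) (λ k → term (n ∸ k)) ≡⟨ ∑-cong (suc n) reindex ⟩
    inverse n                     ∎
    where
    term : ℕ → ℤ
    term k = sgn (n ∸ k) ℤ.* + binomM m (n ∸ k) k
    reindex : ∀ N → N < suc n → term (n ∸ N) ≡ sgn N ℤ.* tpCoeff N n
    reindex N (s≤s N≤n) rewrite m∸[m∸n]≡n N≤n = cong (sgn N ℤ.*_) (begin
      + binomM m N (n ∸ N)   ≡⟨ tpCoeff-binomM N (n ∸ N) ⟨
      tpCoeff N (N + (n ∸ N)) ≡⟨ cong (tpCoeff N) (m+[n∸m]≡n N≤n) ⟩
      tpCoeff N n            ∎)

  inverse-suc-early : ∀ n → n ≤ m → inverse (suc n) ≡ - window (suc n) inverse n
  inverse-suc-early n n≤m = trans (inverse-suc n) (cong -_ (window-saturated (suc m) inverse n (s≤s n≤m)))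

  prefixSum-vanishes : ∀ n → n ≤ m → window (suc (suc n)) inverse (suc n) ≡ + 0
  prefixSum-vanishes n n≤m = trans (cong₂ ℤ._+_ (inverse-suc-early n n≤m) refl)
    (ℤₚ.+-inverseˡ (window (suc n) inverse n))

  period : ℕ
  period = suc (suc m)

  inverse-initial : ∀ r → r < period → inverse r ≡ χ₀ r
  inverse-initial zero          _               = refl
  inverse-initial (suc zero)    _               = inverse-suc 0
  inverse-initial (suc (suc j)) (s≤s (s≤s j<m)) =
    trans (inverse-suc-early (suc j) j<m) (cong -_ (prefixSum-vanishes j (<⇒≤ j<m)))

  inverse-periodic : ∀ k → inverse (period + k) ≡ inverse k
  inverse-periodic k = begin
    inverse (period + k)
      ≡⟨ inverse-suc (suc (m + k)) ⟩
    - (inverse (suc (m + k)) ℤ.+ w)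
      ≡⟨ cong (λ x → - (x ℤ.+ w)) (trans (inverse-suc (m + k)) (cong -_ (window-last m inverse k))) ⟩
    - (- (w ℤ.+ inverse k) ℤ.+ w)
      ≡⟨ cancel w (inverse k) ⟩
    inverse k ∎
    where
    w : ℤ
    w = window m inverse (m + k)
    cancel : ∀ w a → - (- (w ℤ.+ a) ℤ.+ w) ≡ a
    cancel = solve-∀

  inverse-periodic-* : ∀ r q → inverse (r + q * period) ≡ inverse r
  inverse-periodic-* r zero    = cong inverse (+-identityʳ r)
  inverse-periodic-* r (suc q) = begin
    inverse (r + (period + q * period)) ≡⟨ cong inverse (+-comm r (period + q * period)) ⟩
    inverse (period + q * period + r)   ≡⟨ cong inverse (+-assoc period (q * period) r) ⟩
    inverse (period + (q * period + r)) ≡⟨ inverse-periodic (q * period + r) ⟩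
    inverse (q * period + r)            ≡⟨ cong inverse (+-comm (q * period) r) ⟩
    inverse (r + q * period)            ≡⟨ inverse-periodic-* r q ⟩
    inverse r                           ∎

  inverse≡χ₀-mod : ∀ n → inverse n ≡ χ₀ (n % period)
  inverse≡χ₀-mod n = begin
    inverse n                                   ≡⟨ cong inverse (m≡m%n+[m/n]*n n period) ⟩
    inverse (n % period + (n / period) * period) ≡⟨ inverse-periodic-* (n % period) (n / period) ⟩
    inverse (n % period)                        ≡⟨ inverse-initial (n % period) (m%n<n n period) ⟩
    χ₀ (n % period)                             ∎

mainTheorem6 : (m : ℕ) → m ≥ 1 → (n : ℕ) → lhsSum m n ≡ χ (m + 1) n
mainTheorem6 m _ n = begin
  lhsSum m n               ≡⟨ lhsSum≡inverse n ⟩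
  inverse n                ≡⟨ inverse≡χ₀-mod n ⟩
  χ₀ (n % suc (suc m))     ≡⟨ χ≡χ₀-mod (suc m) n ⟨
  χ (suc m) n              ≡⟨ cong (λ r → χ r n) (+-comm 1 m) ⟩
  χ (m + 1) n              ∎
  where open InverseOfP m
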